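{- For $n\ge2$: $\chi_1^{(n)}=\mathrm{C}_{n-1}$, $\chi_{n-1}^{(n)}=n-1$, $\chi_n^{(n)}=1$, and for every $k\in[2,n-1]$, $$\chi_k^{(n)}=\chi_{k-1}^{(n-1)}+\chi_{k+1}^{(n)}.$$
   Context: $\mathrm{C}_m=\frac{1}{m+1}\binom{2m}{m}$ is the $m$-th Catalan number. TL-diagrams on $n$ points: non-crossing perfect matchings of top points $1,\dots,n$ and bottom points $1',\dots,n'$ drawn as $n$ disjoint arcs in the strip $\mathbb{R}\times[0,1]$, up to isotopy; the left side is the unbounded complementary region containing points $(x,1/2)$ with $x$ very negative; an arc is exposed to the left side if it lies on the boundary of that region. For $k\in[1,n]$, $\chi_k^{(n)}$ is the number of TL-diagrams on $n$ points with exactly $k$ arcs exposed to the left side. -}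

module Defs where

open import Data.Nat using (ℕ; zero; suc; _+_; _*_; _∸_)
open import Data.Nat.Combinatorics using (_C_)
open import Data.Nat.DivMod using (_/_)
open import Data.Fin using (Fin; _<_; toℕ; fromℕ<; opposite)
open import Data.Fin.Properties using (all?; _<?_; _≟_)
open import Data.Vec using (Vec; []; _∷_; lookup)
open import Data.List using (List; []; _∷_; [_]; map; concatMap; filter; length; allFin)
open import Data.Product using (_×_)
open import Relation.Binary.PropositionalEquality using (_≡_)
open import Relation.Nullary using (¬_; Dec)
open import Relation.Nullary.Decidable using (_×-dec_; ¬?)
import Data.Nat.Properties as ℕP

catalan : ℕ → ℕ
catalan m = ((2 * m) C m) / suc m

-- Boundary points of the strip, listed in cyclic (counter-clockwise around
-- the boundary of the compactified strip) order as positions 0 .. 2n-1: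
--   top point i (1 ≤ i ≤ n)      ↦ position i-1
--   bottom point i' (1 ≤ i ≤ n)  ↦ position 2n-i
-- The left end of the strip sits on the boundary between position 2n-1
-- (bottom point 1') and position 0 (top point 1).
Point : ℕ → Set
Point n = Fin (n + n)

top : ∀ {n} → Fin n → Point n
top {n} i = i Data.Fin.↑ˡ n

bottom : ∀ {n} → Fin n → Point n
bottom {n} i = opposite (top {n} i)

Cand : ℕ → Set
Cand n = Vec (Point n) (n + n)

partner : ∀ {n} → Cand n → Point n → Point n
partner v a = lookup v a

IsPerfectMatching : ∀ {n} → Cand n → Set
IsPerfectMatching {n} v = (∀ a → partner {n} v (partner {n} v a) ≡ a) × (∀ a → ¬ (partner {n} v a ≡ a))

IsNonCrossing : ∀ {n} → Cand n → Set
IsNonCrossing {n} v = ∀ a c → ¬ (a < c × c < partner {n} v a × partner {n} v a < partner {n} v c)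

IsTL : ∀ {n} → Cand n → Set
IsTL {n} v = IsPerfectMatching {n} v × IsNonCrossing {n} v

-- The arc {a, partner a} with a < partner a is exposed to the left side iff
-- it is not nested inside another arc {c,d}, c < a < partner a < d.
IsExposedLeft : ∀ {n} → Cand n → Point n → Set
IsExposedLeft {n} v a = (a < partner {n} v a) × (∀ (c : Point n) → ¬ (c < a × partner {n} v a < partner {n} v c))

isPM? : ∀ {n} (v : Cand n) → Dec (IsPerfectMatching {n} v)
isPM? {n} v = all? (λ a → partner {n} v (partner {n} v a) ≟ a) ×-dec all? (λ a → ¬? (partner {n} v a ≟ a))

isNC? : ∀ {n} (v : Cand n) → Dec (IsNonCrossing {n} v)
isNC? {n} v = all? λ a → all? λ c → ¬? (a <? c ×-dec (c <? partner {n} v a ×-dec partner {n} v a <? partner {n} v c))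

isTL? : ∀ {n} (v : Cand n) → Dec (IsTL {n} v)
isTL? {n} v = isPM? {n} v ×-dec isNC? {n} v

isExposedLeft? : ∀ {n} (v : Cand n) (a : Point n) → Dec (IsExposedLeft {n} v a)
isExposedLeft? {n} v a = (a <? partner {n} v a) ×-dec all? (λ c → ¬? (c <? a ×-dec partner {n} v a <? partner {n} v c))

exposedLeft : ∀ {n} → Cand n → ℕ
exposedLeft {n} v = length (filter (isExposedLeft? {n} v) (allFin (n + n)))

allVecs : ∀ {M} m → List (Vec (Fin M) m)
allVecs zero = [ [] ]
allVecs {M} (suc m) = concatMap (λ i → map (i ∷_) (allVecs m)) (allFin M)

χ : ℕ → ℕ → ℕ
χ n k = length (filter (λ v → isTL? {n} v ×-dec (exposedLeft {n} v Data.Nat.≟ k)) (allVecs {n + n} (n + n)))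

-- Read along the boundary, a TL-diagram on n points is a non-crossing perfect matching of
-- 2n points on a line, and its arcs nest like a plane forest with n nodes: the arcs directly
-- inside an arc are its children. The arcs exposed to the left side are the outermost ones,
-- i.e. the roots, so χ n k counts forests with n nodes and k roots. If a forest has k ≥ 2
-- roots, either its first root is a leaf, and deleting it leaves n - 1 nodes and k - 1 roots,
-- or it is not; viewing the forest as a binary tree whose right spine is the list of roots,
-- a rotation at the root then lengthens the spine by one, bijectively onto the forests with
-- k + 1 roots. This is the recurrence. Since no forest has more roots than nodes, it gives
-- χ n n = 1 and χ n (n - 1) = n - 1, and by Pascal's rule χ n k is the ballot number
-- C(2n-k-1, n-1) - C(2n-k-1, n), which for k = 1 is the Catalan number C_{n-1}.

module Submission where

open import Defs
open import Data.Nat using (ℕ; suc; _+_; _∸_; _≤_)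
open import Data.Product using (_×_)
open import Relation.Binary.PropositionalEquality using (_≡_)

open import Data.Nat using (zero; _<_; z≤n; s≤s; z<s; _<?_; _≤?_; _*_; _⊓_; _⊔_)
open import Data.Nat.Properties
open import Data.Nat.DivMod using (_/_; m*n/n≡m)
open import Data.Nat.Combinatorics using (_C_; nCk+nC[k+1]≡[n+1]C[k+1]; nCk≡nC[n∸k]; nCn≡1; k>n⇒nCk≡0; nC1≡n)
open import Data.Nat.Tactic.RingSolver using (solve-∀)
open import Data.Product using (∃; _,_; proj₁; proj₂)
open import Data.Sum using (inj₁; inj₂)
open import Function using (id; _∘_)
open import Data.Empty using (⊥; ⊥-elim)
open import Data.Unit using (⊤; tt)
open import Data.Fin using (Fin; toℕ; fromℕ<)
import Data.Fin as Fin
import Data.Fin.Properties as Finₚ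
open import Data.Vec using (Vec; []; _∷_; lookup; tabulate)
import Data.Vec.Properties as Vecₚ
open import Data.List using (List; []; _∷_; _++_; length; filter; map; allFin)
open import Data.List.Properties using (length-++; filter-none)
open import Data.List.Membership.Propositional using (_∈_)
open import Data.List.Membership.Propositional.Properties
  using (∈-∃++; ∈-++⁻; ∈-++⁺ˡ; ∈-++⁺ʳ; ∈-filter⁺; ∈-filter⁻; ∈-allFin; ∈-map⁺; ∈-map⁻; ∈-concatMap⁺)
open import Data.List.Relation.Unary.Any using (here; there)
import Data.List.Relation.Unary.Any as Any
import Data.List.Relation.Unary.All as All
import Data.List.Relation.Unary.All.Properties as Allₚ
import Data.List.Relation.Unary.AllPairs as AllPairs
import Data.List.Relation.Unary.AllPairs.Properties as AllPairsₚ
open import Data.List.Relation.Binary.Disjoint.Propositional using (Disjoint)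
open import Data.List.Relation.Unary.Unique.Propositional using (Unique)
import Data.List.Relation.Unary.Unique.Propositional.Properties as Uniqueₚ
open import Relation.Nullary using (¬_; yes; no)
open import Relation.Nullary.Decidable using (_×-dec_; _→-dec_; ¬?)
open import Relation.Unary using (Decidable)
open import Relation.Binary.Definitions using (tri<; tri≈; tri>)
open import Relation.Binary.PropositionalEquality
  using (refl; sym; trans; cong; cong₂; subst; subst₂; _≢_; module ≡-Reasoning)

module _ {A B : Set} where

  length-≤-by-injection : (xs : List A) (ys : List B) → Unique xs → (f : A → B) →
    (∀ {x x′} → x ∈ xs → x′ ∈ xs → f x ≡ f x′ → x ≡ x′) →
    (∀ {x} → x ∈ xs → f x ∈ ys) → length xs ≤ length ys
  length-≤-by-injection [] ys _ f inj into = z≤n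
  length-≤-by-injection (x ∷ xs) ys (x∉xs AllPairs.∷ xs!) f inj into
    with us , vs , refl ← ∈-∃++ (into (here refl)) = begin
      suc (length xs)           ≤⟨ s≤s (length-≤-by-injection xs (us ++ vs) xs! f
                                     (λ p q → inj (there p) (there q)) into′) ⟩
      suc (length (us ++ vs))   ≡⟨ cong suc (length-++ us) ⟩
      suc (length us + length vs) ≡⟨ +-suc (length us) (length vs) ⟨
      length us + length (f x ∷ vs) ≡⟨ length-++ us ⟨
      length (us ++ f x ∷ vs)   ∎
    where
    open ≤-Reasoning
    into′ : ∀ {x′} → x′ ∈ xs → f x′ ∈ us ++ vs
    into′ {x′} x′∈xs with ∈-++⁻ us (into (there x′∈xs))
    ... | inj₁ p          = ∈-++⁺ˡ p
    ... | inj₂ (here eq)  = ⊥-elim (All.lookup x∉xs x′∈xs (inj (here refl) (there x′∈xs) (sym eq)))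
    ... | inj₂ (there p)  = ∈-++⁺ʳ us p

module _ {A B : Set} {P : A → Set} {Q : B → Set} (P? : Decidable P) (Q? : Decidable Q) where

  length-filter-≤ : {xs : List A} {ys : List B} → Unique xs → (∀ y → y ∈ ys) →
    (f : A → B) → (∀ {x} → P x → Q (f x)) →
    (∀ {x x′} → P x → P x′ → f x ≡ f x′ → x ≡ x′) →
    length (filter P? xs) ≤ length (filter Q? ys)
  length-filter-≤ {xs} {ys} xs! ys-all f PQ inj =
    length-≤-by-injection (filter P? xs) (filter Q? ys) (Uniqueₚ.filter⁺ P? xs!) f
      (λ p q → inj (proj₂ (∈-filter⁻ P? {xs = xs} p)) (proj₂ (∈-filter⁻ P? {xs = xs} q)))
      (λ p → ∈-filter⁺ Q? (ys-all _) (PQ (proj₂ (∈-filter⁻ P? {xs = xs} p))))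

module _ {A B : Set} {P : A → Set} {Q : B → Set} (P? : Decidable P) (Q? : Decidable Q) where

  length-filter-≡-by-bijection : {xs : List A} {ys : List B} →
    Unique xs → Unique ys → (∀ x → x ∈ xs) → (∀ y → y ∈ ys) →
    (f : A → B) (g : B → A) → (∀ {x} → P x → Q (f x)) → (∀ {y} → Q y → P (g y)) →
    (∀ {x} → P x → g (f x) ≡ x) → (∀ {y} → Q y → f (g y) ≡ y) →
    length (filter P? xs) ≡ length (filter Q? ys)
  length-filter-≡-by-bijection xs! ys! xs-all ys-all f g PQ QP gf fg = ≤-antisym
    (length-filter-≤ P? Q? xs! ys-all f PQ (λ p q eq → trans (sym (gf p)) (trans (cong g eq) (gf q))))
    (length-filter-≤ Q? P? ys! xs-all g QP (λ p q eq → trans (sym (fg p)) (trans (cong f eq) (fg q))))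

module _ {A : Set} {P R : A → Set} (P? : Decidable P) (R? : Decidable R) where

  length-filter-by-cases : ∀ xs → length (filter P? xs) ≡
    length (filter (λ x → P? x ×-dec R? x) xs) + length (filter (λ x → P? x ×-dec ¬? (R? x)) xs)
  length-filter-by-cases [] = refl
  length-filter-by-cases (x ∷ xs) with P? x | R? x
  ... | yes _ | yes _ = cong suc (length-filter-by-cases xs)
  ... | yes _ | no _  = trans (cong suc (length-filter-by-cases xs)) (sym (+-suc _ _))
  ... | no _  | yes _ = length-filter-by-cases xs
  ... | no _  | no _  = length-filter-by-cases xs

∈-allVecs : ∀ {M} m (v : Vec (Fin M) m) → v ∈ allVecs m
∈-allVecs zero [] = here refl
∈-allVecs (suc m) (i ∷ v) =
  ∈-concatMap⁺ (λ j → map (j ∷_) (allVecs m)) (Any.map (λ { refl → ∈-map⁺ (i ∷_) (∈-allVecs m v) }) (∈-allFin i))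

allVecs-Unique : ∀ {M} m → Unique (allVecs {M} m)
allVecs-Unique zero = All.[] AllPairs.∷ AllPairs.[]
allVecs-Unique {M} (suc m) = Uniqueₚ.concat⁺
  (Allₚ.map⁺ (All.universal (λ i → Uniqueₚ.map⁺ Vecₚ.∷-injectiveʳ (allVecs-Unique m)) _))
  (AllPairsₚ.map⁺ (AllPairs.map disjoint (Uniqueₚ.allFin⁺ M)))
  where
  disjoint : ∀ {i j} → i ≢ j → Disjoint (map (i ∷_) (allVecs m)) (map (j ∷_) (allVecs m))
  disjoint i≢j (u∈ , v∈) with ∈-map⁻ _ u∈ | ∈-map⁻ _ v∈
  ... | _ , _ , refl | _ , _ , eq = i≢j (Vecₚ.∷-injectiveˡ eq)

-- Forests as non-crossing matchings

-- node c f : a first tree whose root has the subforest c, followed by the forest f.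
-- Drawn as arcs on a line, the first root is an outermost arc enclosing c, with f to its right.
data Forest : Set where
  ∅    : Forest
  node : Forest → Forest → Forest

size : Forest → ℕ
size ∅          = 0
size (node c f) = suc (size c + size f)

roots : Forest → ℕ
roots ∅          = 0
roots (node _ f) = suc (roots f)

span : Forest → ℕ
span ∅          = 0
span (node c f) = suc (span c + suc (span f))

span≡size+size : ∀ t → span t ≡ size t + size t
span≡size+size ∅ = refl
span≡size+size (node c f) = begin
  suc (span c + suc (span f))                 ≡⟨ cong₂ (λ a b → suc (a + suc b)) (span≡size+size c) (span≡size+size f) ⟩
  suc ((size c + size c) + suc (size f + size f)) ≡⟨ regroup (size c) (size f) ⟩
  suc (size c + size f) + suc (size c + size f) ∎
  where
  open ≡-Reasoning
  regroup : ∀ a b → suc ((a + a) + suc (b + b)) ≡ suc (a + b) + suc (a + b)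
  regroup = solve-∀

roots≤size : ∀ t → roots t ≤ size t
roots≤size ∅          = z≤n
roots≤size (node c f) = s≤s (≤-trans (roots≤size f) (m≤n+m (size f) (size c)))

-- Position of the arc closing the first root of node c f, laid out from s.
closer : ℕ → Forest → ℕ
closer s c = suc s + span c

s+span-node : ∀ s c f → s + span (node c f) ≡ suc (closer s c) + span f
s+span-node s c f = shuffle s (span c) (span f)
  where
  shuffle : ∀ s a b → s + suc (a + suc b) ≡ suc (suc s + a) + b
  shuffle = solve-∀

s<closer : ∀ s c → s < closer s c
s<closer s c = s≤s (m≤m+n s (span c))

joinArc : (ℕ → ℕ) → (ℕ → ℕ) → ℕ → ℕ → ℕ → ℕ
joinArc inner outer s p x with <-cmp x s
... | tri< _ _ _ = x
... | tri≈ _ _ _ = p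
... | tri> _ _ _ with <-cmp x p
...   | tri< _ _ _ = inner x
...   | tri≈ _ _ _ = s
...   | tri> _ _ _ = outer x

module _ (inner outer : ℕ → ℕ) (s p : ℕ) where

  joinArc-start : joinArc inner outer s p s ≡ p
  joinArc-start with <-cmp s s
  ... | tri< s<s _ _ = ⊥-elim (<-irrefl refl s<s)
  ... | tri≈ _ _ _   = refl
  ... | tri> _ _ s>s = ⊥-elim (<-irrefl refl s>s)

  joinArc-inside : ∀ {x} → s < x → x < p → joinArc inner outer s p x ≡ inner x
  joinArc-inside {x} s<x x<p with <-cmp x s
  ... | tri< x<s _ _ = ⊥-elim (<-asym x<s s<x)
  ... | tri≈ _ x≡s _ = ⊥-elim (<-irrefl (sym x≡s) s<x)
  ... | tri> _ _ _ with <-cmp x p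
  ...   | tri< _ _ _   = refl
  ...   | tri≈ _ x≡p _ = ⊥-elim (<-irrefl x≡p x<p)
  ...   | tri> _ _ x>p = ⊥-elim (<-asym x>p x<p)

  joinArc-end : s < p → joinArc inner outer s p p ≡ s
  joinArc-end s<p with <-cmp p s
  ... | tri< p<s _ _ = ⊥-elim (<-asym p<s s<p)
  ... | tri≈ _ p≡s _ = ⊥-elim (<-irrefl (sym p≡s) s<p)
  ... | tri> _ _ _ with <-cmp p p
  ...   | tri< p<p _ _ = ⊥-elim (<-irrefl refl p<p)
  ...   | tri≈ _ _ _   = refl
  ...   | tri> _ _ p>p = ⊥-elim (<-irrefl refl p>p)

  joinArc-after : ∀ {x} → s < p → p < x → joinArc inner outer s p x ≡ outer x
  joinArc-after {x} s<p p<x with <-cmp x s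
  ... | tri< x<s _ _ = ⊥-elim (<-asym x<s (<-trans s<p p<x))
  ... | tri≈ _ x≡s _ = ⊥-elim (<-irrefl (sym x≡s) (<-trans s<p p<x))
  ... | tri> _ _ _ with <-cmp x p
  ...   | tri< x<p _ _ = ⊥-elim (<-asym x<p p<x)
  ...   | tri≈ _ x≡p _ = ⊥-elim (<-irrefl (sym x≡p) p<x)
  ...   | tri> _ _ _   = refl

data Region (s p e x : ℕ) : Set where
  start  : x ≡ s → Region s p e x
  inside : s < x → x < p → Region s p e x
  end    : x ≡ p → Region s p e x
  after  : p < x → x < e → Region s p e x

region : ∀ s p e {x} → s ≤ x → x < e → Region s p e x
region s p e {x} s≤x x<e with <-cmp x s
... | tri< x<s _ _ = ⊥-elim (<⇒≱ x<s s≤x)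
... | tri≈ _ x≡s _ = start x≡s
... | tri> _ _ x>s with <-cmp x p
...   | tri< x<p _ _ = inside x>s x<p
...   | tri≈ _ x≡p _ = end x≡p
...   | tri> _ _ x>p = after x>p x<e

record IsNCMatchingOn (g : ℕ → ℕ) (s e : ℕ) : Set where
  field
    ≥-start       : ∀ {x} → s ≤ x → x < e → s ≤ g x
    <-end         : ∀ {x} → s ≤ x → x < e → g x < e
    involutive    : ∀ {x} → s ≤ x → x < e → g (g x) ≡ x
    fixpoint-free : ∀ {x} → s ≤ x → x < e → g x ≢ x
    noncrossing   : ∀ {a c} → s ≤ a → a < e → s ≤ c → c < e → a < c → c < g a → g a < g c → ⊥
open IsNCMatchingOn

joinArc-isNCMatching : ∀ {inner outer s p e} → s < p → p < e →
  IsNCMatchingOn inner (suc s) p → IsNCMatchingOn outer (suc p) e →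
  IsNCMatchingOn (joinArc inner outer s p) s e
joinArc-isNCMatching {inner} {outer} {s} {p} {e} s<p p<e I O = record
  { ≥-start = lo ; <-end = hi ; involutive = inv ; fixpoint-free = nofix ; noncrossing = nocross }
  where
  G = joinArc inner outer s p
  G-start = joinArc-start inner outer s p
  G-end = joinArc-end inner outer s p s<p
  G-in : ∀ {x} → s < x → x < p → G x ≡ inner x
  G-in = joinArc-inside inner outer s p
  G-out : ∀ {x} → p < x → G x ≡ outer x
  G-out = joinArc-after inner outer s p s<p

  lo : ∀ {x} → s ≤ x → x < e → s ≤ G x
  lo s≤x x<e with region s p e s≤x x<e
  ... | start refl = subst (s ≤_) (sym G-start) (<⇒≤ s<p)
  ... | inside a b = subst (s ≤_) (sym (G-in a b)) (<⇒≤ (≥-start I a b))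
  ... | end refl   = subst (s ≤_) (sym G-end) ≤-refl
  ... | after a b  = subst (s ≤_) (sym (G-out a)) (<⇒≤ (<-trans s<p (≥-start O a b)))

  hi : ∀ {x} → s ≤ x → x < e → G x < e
  hi s≤x x<e with region s p e s≤x x<e
  ... | start refl = subst (_< e) (sym G-start) p<e
  ... | inside a b = subst (_< e) (sym (G-in a b)) (<-trans (<-end I a b) p<e)
  ... | end refl   = subst (_< e) (sym G-end) (<-trans s<p p<e)
  ... | after a b  = subst (_< e) (sym (G-out a)) (<-end O a b)

  inv : ∀ {x} → s ≤ x → x < e → G (G x) ≡ x
  inv s≤x x<e with region s p e s≤x x<e
  ... | start refl = trans (cong G G-start) G-end
  ... | inside a b = trans (cong G (G-in a b)) (trans (G-in (≥-start I a b) (<-end I a b)) (involutive I a b))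
  ... | end refl   = trans (cong G G-end) G-start
  ... | after a b  = trans (cong G (G-out a)) (trans (G-out (≥-start O a b)) (involutive O a b))

  nofix : ∀ {x} → s ≤ x → x < e → G x ≢ x
  nofix s≤x x<e with region s p e s≤x x<e
  ... | start refl = λ eq → <-irrefl (sym (trans (sym G-start) eq)) s<p
  ... | inside a b = λ eq → fixpoint-free I a b (trans (sym (G-in a b)) eq)
  ... | end refl   = λ eq → <-irrefl (trans (sym G-end) eq) s<p
  ... | after a b  = λ eq → fixpoint-free O a b (trans (sym (G-out a)) eq)

  nocross : ∀ {a c} → s ≤ a → a < e → s ≤ c → c < e → a < c → c < G a → G a < G c → ⊥
  nocross {a} {c} s≤a a<e s≤c c<e a<c c<Ga Ga<Gc with region s p e s≤a a<e
  nocross {a} {c} s≤a a<e s≤c c<e a<c c<Ga Ga<Gc | start refl with region s p e s≤c c<e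
  ... | start refl = <-irrefl refl a<c
  ... | inside c₁ c₂ = <-asym (subst (_< G c) G-start Ga<Gc) (subst (_< p) (sym (G-in c₁ c₂)) (<-end I c₁ c₂))
  ... | end refl   = <-irrefl (sym G-start) c<Ga
  ... | after c₁ _ = <-asym c₁ (subst (_ <_) G-start c<Ga)
  nocross {a} {c} s≤a a<e s≤c c<e a<c c<Ga Ga<Gc | inside a₁ a₂ =
    let c<Ia = subst (_ <_) (G-in a₁ a₂) c<Ga
        c<p = <-trans c<Ia (<-end I a₁ a₂)
        s<c = <-trans a₁ a<c
    in noncrossing I a₁ a₂ s<c c<p a<c c<Ia (subst₂ _<_ (G-in a₁ a₂) (G-in s<c c<p) Ga<Gc)
  nocross {a} {c} s≤a a<e s≤c c<e a<c c<Ga Ga<Gc | end refl = <-asym (<-trans s<p a<c) (subst (_ <_) G-end c<Ga)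
  nocross {a} {c} s≤a a<e s≤c c<e a<c c<Ga Ga<Gc | after a₁ a₂ =
    let p<c = <-trans a₁ a<c
    in noncrossing O a₁ a₂ p<c c<e a<c (subst (_ <_) (G-out a₁) c<Ga) (subst₂ _<_ (G-out a₁) (G-out p<c) Ga<Gc)

-- The partner function of the arc diagram of t drawn on the points s, …, s + span t - 1
-- (and the identity elsewhere).
layout : Forest → ℕ → ℕ → ℕ
layout ∅          s x = x
layout (node c f) s x = joinArc (layout c (suc s)) (layout f (suc (closer s c))) s (closer s c) x

no-point-in-∅ : ∀ {s x} → s ≤ x → x < s + span ∅ → ⊥
no-point-in-∅ {s} s≤x x<s+0 = <⇒≱ (subst (_ <_) (+-identityʳ s) x<s+0) s≤x

layout-isNCMatching : ∀ t s → IsNCMatchingOn (layout t s) s (s + span t)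
layout-isNCMatching ∅ s = record
  { ≥-start = λ a b → ⊥-elim (no-point-in-∅ a b) ; <-end = λ a b → ⊥-elim (no-point-in-∅ a b)
  ; involutive = λ a b → ⊥-elim (no-point-in-∅ a b) ; fixpoint-free = λ a b → ⊥-elim (no-point-in-∅ a b)
  ; noncrossing = λ a b _ _ _ _ _ → ⊥-elim (no-point-in-∅ a b) }
layout-isNCMatching (node c f) s = subst (IsNCMatchingOn (layout (node c f) s) s) (sym (s+span-node s c f))
  (joinArc-isNCMatching (s<closer s c) (s≤s (m≤m+n _ (span f)))
    (layout-isNCMatching c (suc s)) (layout-isNCMatching f (suc (closer s c))))

-- Exposed arcs are roots

count : {P : ℕ → Set} → Decidable P → ℕ → ℕ → ℕ
count P? s zero = 0
count P? s (suc L) with P? s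
... | yes _ = suc (count P? (suc s) L)
... | no _  = count P? (suc s) L

private
  shrink : ∀ {R : ℕ → Set} {s L} → (∀ {x} → s ≤ x → x < s + suc L → R x) →
    ∀ {x} → suc s ≤ x → x < suc s + L → R x
  shrink {s = s} {L} h {x} s<x x<e = h (<⇒≤ s<x) (subst (x <_) (sym (+-suc s L)) x<e)

module _ {P : ℕ → Set} (P? : Decidable P) where

  count-yes : ∀ {s} L → P s → count P? s (suc L) ≡ suc (count P? (suc s) L)
  count-yes {s} L Ps with P? s
  ... | yes _  = refl
  ... | no ¬Ps = ⊥-elim (¬Ps Ps)

  count-no : ∀ {s} L → ¬ P s → count P? s (suc L) ≡ count P? (suc s) L
  count-no {s} L ¬Ps with P? s
  ... | yes Ps = ⊥-elim (¬Ps Ps)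
  ... | no _   = refl

  count-+ : ∀ s L M → count P? s (L + M) ≡ count P? s L + count P? (s + L) M
  count-+ s zero M = cong (λ t → count P? t M) (sym (+-identityʳ s))
  count-+ s (suc L) M with P? s
  ... | yes _ = cong suc rest
    where rest = trans (count-+ (suc s) L M) (cong (λ t → count P? (suc s) L + count P? t M) (sym (+-suc s L)))
  ... | no _  = trans (count-+ (suc s) L M) (cong (λ t → count P? (suc s) L + count P? t M) (sym (+-suc s L)))

  count-none : ∀ s L → (∀ {x} → s ≤ x → x < s + L → ¬ P x) → count P? s L ≡ 0
  count-none s zero none = refl
  count-none s (suc L) none = trans (count-no L (none ≤-refl (m<m+n s z<s)))
    (count-none (suc s) L (shrink none))

module _ {P Q : ℕ → Set} (P? : Decidable P) (Q? : Decidable Q) where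

  count-cong : ∀ s L → (∀ {x} → s ≤ x → x < s + L → P x → Q x) → (∀ {x} → s ≤ x → x < s + L → Q x → P x) →
    count P? s L ≡ count Q? s L
  count-cong s zero _ _ = refl
  count-cong s (suc L) P⇒Q Q⇒P with P? s | Q? s | count-cong (suc s) L (shrink P⇒Q) (shrink Q⇒P)
  ... | yes _  | yes _  | rest = cong suc rest
  ... | yes Ps | no ¬Qs | _    = ⊥-elim (¬Qs (P⇒Q ≤-refl (m<m+n s z<s) Ps))
  ... | no ¬Ps | yes Qs | _    = ⊥-elim (¬Ps (Q⇒P ≤-refl (m<m+n s z<s) Qs))
  ... | no _   | no _   | rest = rest

ExposedOn : (ℕ → ℕ) → ℕ → ℕ → ℕ → Set
ExposedOn g s e a = a < g a × (∀ {c} → c < e → s ≤ c → ¬ (c < a × g a < g c))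

exposedOn? : ∀ g s e → Decidable (ExposedOn g s e)
exposedOn? g s e a = (a <? g a) ×-dec allUpTo? (λ c → (s ≤? c) →-dec ¬? ((c <? a) ×-dec (g a <? g c))) e

module _ {inner outer s p e} (s<p : s < p) (p<e : p < e)
         (I : IsNCMatchingOn inner (suc s) p) (O : IsNCMatchingOn outer (suc p) e) where
  private
    G = joinArc inner outer s p
    G-start = joinArc-start inner outer s p
    G-end = joinArc-end inner outer s p s<p
    G-out : ∀ {x} → p < x → G x ≡ outer x
    G-out = joinArc-after inner outer s p s<p

  joinArc-exposed-start : ExposedOn G s e s
  joinArc-exposed-start = subst (s <_) (sym G-start) s<p , λ _ s≤c (c<s , _) → <⇒≱ c<s s≤c

  joinArc-unexposed-inside : ∀ {x} → s < x → x < p → ¬ ExposedOn G s e x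
  joinArc-unexposed-inside s<x x<p (_ , outermost) = outermost (<-trans s<p p<e) ≤-refl
    (s<x , subst₂ _<_ (sym (joinArc-inside inner outer s p s<x x<p)) (sym G-start) (<-end I s<x x<p))

  joinArc-unexposed-end : ¬ ExposedOn G s e p
  joinArc-unexposed-end (p<Gp , _) = <-asym s<p (subst (p <_) G-end p<Gp)

  joinArc-exposed-after⁺ : ∀ {x} → p < x → x < e → ExposedOn G s e x → ExposedOn outer (suc p) e x
  joinArc-exposed-after⁺ p<x x<e (x<Gx , outermost) = subst (_ <_) (G-out p<x) x<Gx ,
    λ c<e p<c (c<x , Ox<Oc) → outermost c<e (<⇒≤ (<-trans s<p p<c))
      (c<x , subst₂ _<_ (sym (G-out p<x)) (sym (G-out p<c)) Ox<Oc)

  -- Arcs starting before p end at or before p, so they cannot enclose an arc of outer.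
  joinArc-exposed-after⁻ : ∀ {x} → p < x → x < e → ExposedOn outer (suc p) e x → ExposedOn G s e x
  joinArc-exposed-after⁻ {x} p<x x<e (x<Ox , outermost) = subst (x <_) (sym (G-out p<x)) x<Ox , enclosing
    where
    p<Ox = ≥-start O p<x x<e
    enclosing : ∀ {c} → c < e → s ≤ c → ¬ (c < x × G x < G c)
    enclosing {c} c<e s≤c (c<x , Gx<Gc) with region s p e s≤c c<e
    ... | start refl   = <-asym (subst₂ _<_ (G-out p<x) G-start Gx<Gc) p<Ox
    ... | inside c₁ c₂ = <-asym (subst₂ _<_ (G-out p<x) (joinArc-inside inner outer s p c₁ c₂) Gx<Gc)
                                (<-trans (<-end I c₁ c₂) p<Ox)
    ... | end refl     = <-asym (subst₂ _<_ (G-out p<x) G-end Gx<Gc) (<-trans s<p p<Ox)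
    ... | after c₁ _   = outermost c<e c₁ (c<x , subst₂ _<_ (G-out p<x) (G-out c₁) Gx<Gc)

count-exposed-layout : ∀ t s → count (exposedOn? (layout t s) s (s + span t)) s (span t) ≡ roots t
count-exposed-layout ∅ s = refl
count-exposed-layout (node c f) s = begin
  count E? s (suc (span c + suc (span f)))               ≡⟨ count-yes E? _ (joinArc-exposed-start s<p p<e I O) ⟩
  suc (count E? (suc s) (span c + suc (span f)))         ≡⟨ cong suc (count-+ E? (suc s) (span c) (suc (span f))) ⟩
  suc (count E? (suc s) (span c) + count E? p (suc (span f)))
    ≡⟨ cong suc (cong₂ _+_ (count-none E? (suc s) (span c) (joinArc-unexposed-inside s<p p<e I O))
                           (count-no E? (span f) (joinArc-unexposed-end s<p p<e I O))) ⟩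
  suc (count E? (suc p) (span f))
    ≡⟨ cong suc (count-cong E? Eᶠ? (suc p) (span f)
         (λ {x} a b x∈E → subst (λ z → ExposedOn (layout f (suc p)) (suc p) z x) e≡
           (joinArc-exposed-after⁺ s<p p<e I O a (<e b) x∈E))
         (λ {x} a b x∈Eᶠ → joinArc-exposed-after⁻ s<p p<e I O a (<e b)
           (subst (λ z → ExposedOn (layout f (suc p)) (suc p) z x) (sym e≡) x∈Eᶠ))) ⟩
  suc (count Eᶠ? (suc p) (span f))                         ≡⟨ cong suc (count-exposed-layout f (suc p)) ⟩
  suc (roots f)                                          ∎
  where
  open ≡-Reasoning
  p = closer s c
  e = s + span (node c f)
  e≡ : e ≡ suc p + span f
  e≡ = s+span-node s c f
  <e : ∀ {x} → x < suc p + span f → x < e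
  <e {x} = subst (x <_) (sym e≡)
  s<p = s<closer s c
  p<e : p < e
  p<e = <e (s≤s (m≤m+n p (span f)))
  I = layout-isNCMatching c (suc s)
  O : IsNCMatchingOn (layout f (suc p)) (suc p) e
  O = subst (IsNCMatchingOn _ (suc p)) (sym e≡) (layout-isNCMatching f (suc p))
  E? = exposedOn? (layout (node c f) s) s e
  Eᶠ? = exposedOn? (layout f (suc p)) (suc p) (suc p + span f)

-- Reading the forest back off a matching

clampTo : ℕ → ℕ → ℕ → ℕ
clampTo s e y = (y ⊓ e) ⊔ s

clampTo-id : ∀ {s e y} → s ≤ y → y ≤ e → clampTo s e y ≡ y
clampTo-id {s} {e} {y} s≤y y≤e = trans (cong (_⊔ s) (m≤n⇒m⊓n≡m y≤e)) (m≥n⇒m⊔n≡m s≤y)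

-- Reads the forest off a partner function on [s, e), peeling off the arc at s; the fuel
-- bounds the recursion depth, and clamping keeps every subinterval inside [s, e)
-- even when g is not a matching.
unlayout : ℕ → (ℕ → ℕ) → ℕ → ℕ → Forest
unlayout zero       g s e = ∅
unlayout (suc fuel) g s e with e ≤? s
... | yes _ = ∅
... | no _  = node (unlayout fuel g (suc s) (clampTo s e (g s))) (unlayout fuel g (suc (clampTo s e (g s))) e)

unlayout-cong : ∀ fuel {g g′} s e → (∀ {x} → s ≤ x → x < e → g x ≡ g′ x) →
  unlayout fuel g s e ≡ unlayout fuel g′ s e
unlayout-cong zero s e _ = refl
unlayout-cong (suc fuel) {g} {g′} s e g≗g′ with e ≤? s
... | yes _  = refl
... | no e≰s = begin
  node (unlayout fuel g (suc s) q) (unlayout fuel g (suc q) e)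
    ≡⟨ cong₂ node (unlayout-cong fuel (suc s) q (λ a b → g≗g′ (<⇒≤ a) (<-≤-trans b q≤e)))
                  (unlayout-cong fuel (suc q) e (λ a b → g≗g′ (≤-trans s≤q (<⇒≤ a)) b)) ⟩
  node (unlayout fuel g′ (suc s) q) (unlayout fuel g′ (suc q) e)
    ≡⟨ cong (λ y → node (unlayout fuel g′ (suc s) (clampTo s e y)) (unlayout fuel g′ (suc (clampTo s e y)) e))
            (g≗g′ ≤-refl (≰⇒> e≰s)) ⟩
  node (unlayout fuel g′ (suc s) (clampTo s e (g′ s))) (unlayout fuel g′ (suc (clampTo s e (g′ s))) e) ∎
  where
  open ≡-Reasoning
  q = clampTo s e (g s)
  q≤e : q ≤ e
  q≤e = ⊔-lub (m⊓n≤n (g s) e) (<⇒≤ (≰⇒> e≰s))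
  s≤q : s ≤ q
  s≤q = m≤n⊔m (g s ⊓ e) s

unlayout-layout : ∀ fuel t s → span t ≤ fuel → unlayout fuel (layout t s) s (s + span t) ≡ t
unlayout-layout zero ∅ s _ = refl
unlayout-layout (suc fuel) ∅ s _ with s + 0 ≤? s
... | yes _   = refl
... | no s≰s  = ⊥-elim (s≰s (≤-reflexive (+-identityʳ s)))
unlayout-layout (suc fuel) (node c f) s (s≤s span≤fuel) with s + span (node c f) ≤? s
... | yes e≤s = ⊥-elim (<⇒≱ (m<m+n s z<s) e≤s)
... | no _    = cong₂ node inner outer
  where
  open ≡-Reasoning
  p = closer s c
  e = s + span (node c f)
  G = layout (node c f) s
  q≡p : clampTo s e (G s) ≡ p
  q≡p = trans (cong (clampTo s e) (joinArc-start _ _ s p))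
    (clampTo-id (<⇒≤ (s<closer s c)) (subst (p ≤_) (sym (s+span-node s c f)) (≤-trans (n≤1+n p) (m≤m+n _ (span f)))))
  inner : unlayout fuel G (suc s) (clampTo s e (G s)) ≡ c
  inner = begin
    unlayout fuel G (suc s) (clampTo s e (G s))
      ≡⟨ cong (unlayout fuel G (suc s)) q≡p ⟩
    unlayout fuel G (suc s) p
      ≡⟨ unlayout-cong fuel (suc s) p (joinArc-inside _ _ s p) ⟩
    unlayout fuel (layout c (suc s)) (suc s) p
      ≡⟨ unlayout-layout fuel c (suc s) (≤-trans (m≤m+n (span c) _) span≤fuel) ⟩
    c ∎
  outer : unlayout fuel G (suc (clampTo s e (G s))) e ≡ f
  outer = begin
    unlayout fuel G (suc (clampTo s e (G s))) e
      ≡⟨ cong₂ (λ a b → unlayout fuel G (suc a) b) q≡p (s+span-node s c f) ⟩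
    unlayout fuel G (suc p) (suc p + span f)
      ≡⟨ unlayout-cong fuel (suc p) (suc p + span f) (λ a _ → joinArc-after _ _ s p (s<closer s c) a) ⟩
    unlayout fuel (layout f (suc p)) (suc p) (suc p + span f)
      ≡⟨ unlayout-layout fuel f (suc p) (≤-trans (≤-trans (n≤1+n _) (m≤n+m (suc (span f)) (span c))) span≤fuel) ⟩
    f ∎

module ArcSplit {g s e} (M : IsNCMatchingOn g s e) (s<e : s < e) where

  s<g-s : s < g s
  s<g-s = ≤∧≢⇒< (≥-start M ≤-refl s<e) (λ eq → fixpoint-free M ≤-refl s<e (sym eq))

  g-s<e : g s < e
  g-s<e = <-end M ≤-refl s<e

  private
    g-injective : ∀ {x y} → s ≤ x → x < e → s ≤ y → y < e → g x ≡ g y → x ≡ y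
    g-injective s≤x x<e s≤y y<e eq = trans (sym (involutive M s≤x x<e)) (trans (cong g eq) (involutive M s≤y y<e))

    inside-stays : ∀ {x} → s < x → x < g s → s < g x × g x < g s
    inside-stays {x} s<x x<gs = s<gx , gx<gs
      where
      x<e = <-trans x<gs g-s<e
      s<gx : s < g x
      s<gx = ≤∧≢⇒< (≥-start M (<⇒≤ s<x) x<e)
        (λ s≡gx → <-irrefl (trans (sym (involutive M (<⇒≤ s<x) x<e)) (cong g (sym s≡gx))) x<gs)
      gx<gs : g x < g s
      gx<gs with <-cmp (g x) (g s)
      ... | tri< lt _ _ = lt
      ... | tri≈ _ eq _ = ⊥-elim (<-irrefl (g-injective ≤-refl s<e (<⇒≤ s<x) x<e (sym eq)) s<x)
      ... | tri> _ _ gt = ⊥-elim (noncrossing M ≤-refl s<e (<⇒≤ s<x) x<e s<x x<gs gt)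

    outside-stays : ∀ {x} → g s < x → x < e → g s < g x
    outside-stays {x} gs<x x<e with <-cmp (g x) (g s)
    ... | tri> _ _ gt = gt
    ... | tri≈ _ eq _ = ⊥-elim (<-irrefl (g-injective ≤-refl s<e s≤x x<e (sym eq)) (<-trans s<g-s gs<x))
      where s≤x = <⇒≤ (<-trans s<g-s gs<x)
    ... | tri< lt _ _ = ⊥-elim (<-asym gs<x (subst (_< g s) (involutive M s≤x x<e) (proj₂ (inside-stays s<gx lt))))
      where
      s≤x = <⇒≤ (<-trans s<g-s gs<x)
      s<gx : s < g x
      s<gx = ≤∧≢⇒< (≥-start M s≤x x<e) (λ s≡gx → <-irrefl (trans (cong g s≡gx) (involutive M s≤x x<e)) gs<x)

  inner : IsNCMatchingOn g (suc s) (g s)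
  inner = record
    { ≥-start       = λ a b → proj₁ (inside-stays a b)
    ; <-end         = λ a b → proj₂ (inside-stays a b)
    ; involutive    = λ a b → involutive M (<⇒≤ a) (<-trans b g-s<e)
    ; fixpoint-free = λ a b → fixpoint-free M (<⇒≤ a) (<-trans b g-s<e)
    ; noncrossing   = λ a₁ a₂ c₁ c₂ → noncrossing M (<⇒≤ a₁) (<-trans a₂ g-s<e) (<⇒≤ c₁) (<-trans c₂ g-s<e) }

  outer : IsNCMatchingOn g (suc (g s)) e
  outer = record
    { ≥-start       = outside-stays
    ; <-end         = λ a b → <-end M (s≤ a) b
    ; involutive    = λ a b → involutive M (s≤ a) b
    ; fixpoint-free = λ a b → fixpoint-free M (s≤ a) b
    ; noncrossing   = λ a₁ a₂ c₁ c₂ → noncrossing M (s≤ a₁) a₂ (s≤ c₁) c₂ }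
    where
    s≤ : ∀ {x} → g s < x → s ≤ x
    s≤ gs<x = <⇒≤ (<-trans s<g-s gs<x)

joinArc-agrees : ∀ {inner outer g : ℕ → ℕ} {s p e} → s < p → g s ≡ p → g p ≡ s →
  (∀ {x} → s < x → x < p → inner x ≡ g x) → (∀ {x} → p < x → x < e → outer x ≡ g x) →
  ∀ {x} → s ≤ x → x < e → joinArc inner outer s p x ≡ g x
joinArc-agrees {inner} {outer} {g} {s} {p} {e} s<p gs≡p gp≡s in≗ out≗ s≤x x<e with region s p e s≤x x<e
... | start refl = trans (joinArc-start inner outer s p) (sym gs≡p)
... | inside a b = trans (joinArc-inside inner outer s p a b) (in≗ a b)
... | end refl   = trans (joinArc-end inner outer s p s<p) (sym gp≡s)
... | after a b  = trans (joinArc-after inner outer s p s<p a) (out≗ a b)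

layout-unlayout : ∀ fuel {g s e} → IsNCMatchingOn g s e → s ≤ e → e ≤ s + fuel →
  let t = unlayout fuel g s e in (s + span t ≡ e) × (∀ {x} → s ≤ x → x < e → layout t s x ≡ g x)
layout-unlayout zero {s = s} {e} _ s≤e e≤s+0 =
  trans (+-identityʳ s) (≤-antisym s≤e (subst (e ≤_) (+-identityʳ s) e≤s+0)) ,
  λ s≤x x<e → ⊥-elim (<⇒≱ (≤-trans x<e (subst (e ≤_) (+-identityʳ s) e≤s+0)) s≤x)
layout-unlayout (suc fuel) {g} {s} {e} M s≤e e≤s+fuel with e ≤? s
... | yes e≤s = trans (+-identityʳ s) (≤-antisym s≤e e≤s) , λ s≤x x<e → ⊥-elim (<⇒≱ (≤-trans x<e e≤s) s≤x)
... | no e≰s rewrite clampTo-id (<⇒≤ (ArcSplit.s<g-s M (≰⇒> e≰s))) (<⇒≤ (ArcSplit.g-s<e M (≰⇒> e≰s))) =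
  span-eq , agree
  where
  s<e = ≰⇒> e≰s
  open ArcSplit M s<e
  c = unlayout fuel g (suc s) (g s)
  f = unlayout fuel g (suc (g s)) e
  IH-c = layout-unlayout fuel inner s<g-s (≤-trans (<⇒≤ g-s<e) (subst (e ≤_) (+-suc s fuel) e≤s+fuel))
  IH-f = layout-unlayout fuel outer g-s<e
    (≤-trans (subst (e ≤_) (+-suc s fuel) e≤s+fuel) (+-monoˡ-≤ fuel (s≤s (<⇒≤ s<g-s))))
  closer≡g-s : closer s c ≡ g s
  closer≡g-s = proj₁ IH-c
  span-eq : s + span (node c f) ≡ e
  span-eq = trans (s+span-node s c f) (trans (cong (λ z → suc z + span f) closer≡g-s) (proj₁ IH-f))
  agree : ∀ {x} → s ≤ x → x < e → layout (node c f) s x ≡ g x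
  agree = joinArc-agrees {g = g} (s<closer s c) (sym closer≡g-s)
    (trans (cong g closer≡g-s) (involutive M ≤-refl s<e))
    (λ {x} a b → proj₂ IH-c a (subst (x <_) closer≡g-s b))
    (λ {x} a b → trans (cong (λ z → layout f (suc z) x) closer≡g-s) (proj₂ IH-f (subst (_< x) closer≡g-s a) b))

-- TL-diagrams correspond to forests

partnerℕ : ∀ {n} → Cand n → ℕ → ℕ
partnerℕ {n} v x with x <? n + n
... | yes x<2n = toℕ (lookup v (fromℕ< x<2n))
... | no _     = x

partnerℕ-toℕ : ∀ {n} (v : Cand n) (i : Point n) → partnerℕ {n} v (toℕ i) ≡ toℕ (partner {n} v i)
partnerℕ-toℕ {n} v i with toℕ i <? n + n
... | yes i<2n = cong (λ j → toℕ (lookup v j)) (Finₚ.fromℕ<-toℕ i i<2n)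
... | no i≮2n  = ⊥-elim (i≮2n (Finₚ.toℕ<n i))

-- The fallback value is never used on matchings, whose values are always in range.
fromℕ-else : ∀ {N} → Fin N → ℕ → Fin N
fromℕ-else {N} i x with x <? N
... | yes x<N = fromℕ< x<N
... | no _    = i

toℕ-fromℕ-else : ∀ {N} (i : Fin N) {x} → x < N → toℕ (fromℕ-else i x) ≡ x
toℕ-fromℕ-else {N} i {x} x<N with x <? N
... | yes x<N′ = Finₚ.toℕ-fromℕ< x<N′
... | no x≮N   = ⊥-elim (x≮N x<N)

diagram : ∀ n → Forest → Cand n
diagram n t = tabulate (λ i → fromℕ-else i (layout t 0 (toℕ i)))

forest : ∀ n → Cand n → Forest
forest n v = unlayout (n + n) (partnerℕ {n} v) 0 (n + n)

∃-toℕ : ∀ {N x} → x < N → ∃ λ (i : Fin N) → toℕ i ≡ x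
∃-toℕ x<N = fromℕ< x<N , Finₚ.toℕ-fromℕ< x<N

m+m≡n+n⇒m≡n : ∀ {m n} → m + m ≡ n + n → m ≡ n
m+m≡n+n⇒m≡n {zero}  {zero}  _  = refl
m+m≡n+n⇒m≡n {suc m} {suc n} eq =
  cong suc (m+m≡n+n⇒m≡n (suc-injective (trans (sym (+-suc m m)) (trans (suc-injective eq) (+-suc n n)))))

length-filter-tabulate≡count : ∀ {N M} (f : Fin N → Fin M) {P : Fin M → Set} (P? : Decidable P)
  {Q : ℕ → Set} (Q? : Decidable Q) s → (∀ i → P (f i) → Q (s + toℕ i)) → (∀ i → Q (s + toℕ i) → P (f i)) →
  length (filter P? (Data.List.tabulate f)) ≡ count Q? s N
length-filter-tabulate≡count {zero} f P? Q? s _ _ = refl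
length-filter-tabulate≡count {suc N} f {P} P? {Q} Q? s P⇒Q Q⇒P
  with P? (f Fin.zero) | Q? s | length-filter-tabulate≡count (f ∘ Fin.suc) P? Q? (suc s)
         (λ i Pf → subst Q (+-suc s (toℕ i)) (P⇒Q (Fin.suc i) Pf))
         (λ i Qs → Q⇒P (Fin.suc i) (subst Q (sym (+-suc s (toℕ i))) Qs))
... | yes _  | yes _  | rest = cong suc rest
... | yes Pf | no ¬Qs | _    = ⊥-elim (¬Qs (subst Q (+-identityʳ s) (P⇒Q Fin.zero Pf)))
... | no ¬Pf | yes Qs | _    = ⊥-elim (¬Pf (Q⇒P Fin.zero (subst Q (sym (+-identityʳ s)) Qs)))
... | no _   | no _   | rest = rest

module DiagramOf (t : Forest) where
  private
    n = size t
    N = n + n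
    span≡N : span t ≡ N
    span≡N = span≡size+size t
    D = diagram n t
    M : IsNCMatchingOn (layout t 0) 0 N
    M = subst (IsNCMatchingOn (layout t 0) 0) span≡N (layout-isNCMatching t 0)

  toℕ-partner : ∀ i → toℕ (partner {n} D i) ≡ layout t 0 (toℕ i)
  toℕ-partner i = trans (cong toℕ (Vecₚ.lookup∘tabulate _ i))
    (toℕ-fromℕ-else i (<-end M z≤n (Finₚ.toℕ<n i)))

  isTL : IsTL {n} D
  isTL = (involution , fixpoint-free′) , noncrossing′
    where
    involution : ∀ a → partner {n} D (partner {n} D a) ≡ a
    involution a = Finₚ.toℕ-injective (trans (toℕ-partner (partner {n} D a))
      (trans (cong (layout t 0) (toℕ-partner a)) (involutive M z≤n (Finₚ.toℕ<n a))))
    fixpoint-free′ : ∀ a → ¬ (partner {n} D a ≡ a)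
    fixpoint-free′ a eq = fixpoint-free M z≤n (Finₚ.toℕ<n a) (trans (sym (toℕ-partner a)) (cong toℕ eq))
    noncrossing′ : IsNonCrossing {n} D
    noncrossing′ a c (a<c , c<Da , Da<Dc) = noncrossing M z≤n (Finₚ.toℕ<n a) z≤n (Finₚ.toℕ<n c) a<c
      (subst (toℕ c <_) (toℕ-partner a) c<Da) (subst₂ _<_ (toℕ-partner a) (toℕ-partner c) Da<Dc)

  forest-diagram : forest n D ≡ t
  forest-diagram = begin
    unlayout N (partnerℕ {n} D) 0 N        ≡⟨ unlayout-cong N 0 N agree ⟩
    unlayout N (layout t 0) 0 N            ≡⟨ cong (unlayout N (layout t 0) 0) span≡N ⟨
    unlayout N (layout t 0) 0 (span t)     ≡⟨ unlayout-layout N t 0 (≤-reflexive span≡N) ⟩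
    t                                      ∎
    where
    open ≡-Reasoning
    agree : ∀ {x} → 0 ≤ x → x < N → partnerℕ {n} D x ≡ layout t 0 x
    agree _ x<N with ∃-toℕ x<N
    ... | i , refl = trans (partnerℕ-toℕ {n} D i) (toℕ-partner i)

  exposedLeft-diagram : exposedLeft {n} D ≡ roots t
  exposedLeft-diagram = begin
    exposedLeft {n} D
      ≡⟨ length-filter-tabulate≡count id (isExposedLeft? {n} D) E? 0 exposed⁺ exposed⁻ ⟩
    count E? 0 N
      ≡⟨ cong (λ z → count (exposedOn? (layout t 0) 0 z) 0 z) span≡N ⟨
    count (exposedOn? (layout t 0) 0 (span t)) 0 (span t)
      ≡⟨ count-exposed-layout t 0 ⟩
    roots t ∎
    where
    open ≡-Reasoning
    E? = exposedOn? (layout t 0) 0 N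
    exposed⁺ : ∀ i → IsExposedLeft {n} D i → ExposedOn (layout t 0) 0 N (toℕ i)
    exposed⁺ i (i<Di , outermost) = subst (toℕ i <_) (toℕ-partner i) i<Di , enclosing
      where
      enclosing : ∀ {c} → c < N → 0 ≤ c → ¬ (c < toℕ i × layout t 0 (toℕ i) < layout t 0 c)
      enclosing c<N _ (c<i , Li<Lc) with ∃-toℕ c<N
      ... | j , refl = outermost j (c<i , subst₂ _<_ (sym (toℕ-partner i)) (sym (toℕ-partner j)) Li<Lc)
    exposed⁻ : ∀ i → ExposedOn (layout t 0) 0 N (toℕ i) → IsExposedLeft {n} D i
    exposed⁻ i (i<Li , outermost) = subst (toℕ i <_) (sym (toℕ-partner i)) i<Li ,
      λ c (c<i , Di<Dc) → outermost (Finₚ.toℕ<n c) z≤n (c<i , subst₂ _<_ (toℕ-partner i) (toℕ-partner c) Di<Dc)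

module ForestOf {n} (v : Cand n) (tl : IsTL {n} v) where
  private
    N = n + n
    g = partnerℕ {n} v
    M : IsNCMatchingOn g 0 N
    M = record { ≥-start = λ _ _ → z≤n ; <-end = in-range ; involutive = invol
               ; fixpoint-free = nofix ; noncrossing = nocross }
      where
      in-range : ∀ {x} → 0 ≤ x → x < N → g x < N
      in-range _ x<N with ∃-toℕ x<N
      ... | i , refl = subst (_< N) (sym (partnerℕ-toℕ {n} v i)) (Finₚ.toℕ<n (lookup v i))
      invol : ∀ {x} → 0 ≤ x → x < N → g (g x) ≡ x
      invol _ x<N with ∃-toℕ x<N
      ... | i , refl = trans (cong g (partnerℕ-toℕ {n} v i))
        (trans (partnerℕ-toℕ {n} v (lookup v i)) (cong toℕ (proj₁ (proj₁ tl) i)))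
      nofix : ∀ {x} → 0 ≤ x → x < N → g x ≢ x
      nofix _ x<N with ∃-toℕ x<N
      ... | i , refl = λ eq → proj₂ (proj₁ tl) i (Finₚ.toℕ-injective (trans (sym (partnerℕ-toℕ {n} v i)) eq))
      nocross : ∀ {a c} → 0 ≤ a → a < N → 0 ≤ c → c < N → a < c → c < g a → g a < g c → ⊥
      nocross _ a<N _ c<N a<c c<ga ga<gc with ∃-toℕ a<N | ∃-toℕ c<N
      ... | i , refl | j , refl = proj₂ tl i j (a<c , subst (toℕ j <_) (partnerℕ-toℕ {n} v i) c<ga ,
                                    subst₂ _<_ (partnerℕ-toℕ {n} v i) (partnerℕ-toℕ {n} v j) ga<gc)
    t = forest n v
    inverse = layout-unlayout N M z≤n ≤-refl

  size-forest : size t ≡ n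
  size-forest = m+m≡n+n⇒m≡n (trans (sym (span≡size+size t)) (proj₁ inverse))

  diagram-forest : diagram n t ≡ v
  diagram-forest = trans (Vecₚ.tabulate-cong entry) (Vecₚ.tabulate∘lookup v)
    where
    entry : ∀ i → fromℕ-else i (layout t 0 (toℕ i)) ≡ lookup v i
    entry i = Finₚ.toℕ-injective (trans (toℕ-fromℕ-else i (subst (_< N) (sym same) (Finₚ.toℕ<n (lookup v i)))) same)
      where
      same : layout t 0 (toℕ i) ≡ toℕ (lookup v i)
      same = trans (proj₂ inverse z≤n (Finₚ.toℕ<n i)) (partnerℕ-toℕ {n} v i)

diagram-correct : ∀ {n} t → size t ≡ n →
  IsTL {n} (diagram n t) × (exposedLeft {n} (diagram n t) ≡ roots t) × (forest n (diagram n t) ≡ t)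
diagram-correct t refl = DiagramOf.isTL t , DiagramOf.exposedLeft-diagram t , DiagramOf.forest-diagram t

forest-correct : ∀ {n} v → IsTL {n} v → (size (forest n v) ≡ n) × (diagram n (forest n v) ≡ v)
forest-correct {n} v tl = ForestOf.size-forest {n} v tl , ForestOf.diagram-forest {n} v tl

exposedLeft≡roots-forest : ∀ {n} v → IsTL {n} v → exposedLeft {n} v ≡ roots (forest n v)
exposedLeft≡roots-forest {n} v tl = begin
  exposedLeft {n} v
    ≡⟨ cong (exposedLeft {n}) (proj₂ (forest-correct {n} v tl)) ⟨
  exposedLeft {n} (diagram n (forest n v))
    ≡⟨ proj₁ (proj₂ (diagram-correct (forest n v) (proj₁ (forest-correct {n} v tl)))) ⟩
  roots (forest n v) ∎
  where open ≡-Reasoning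

record SelectsForests (n : ℕ) (P : Cand n → Set) (R : Forest → Set) : Set where
  field
    sound    : ∀ {v} → P v → IsTL {n} v × R (forest n v)
    complete : ∀ {v} → IsTL {n} v → R (forest n v) → P v

record SizedForestBijection (m : ℕ) (R : Forest → Set) (n : ℕ) (S : Forest → Set) : Set where
  field
    to       : Forest → Forest
    from     : Forest → Forest
    to-ok    : ∀ {t} → size t ≡ m → R t → size (to t) ≡ n × S (to t)
    from-ok  : ∀ {t} → size t ≡ n → S t → size (from t) ≡ m × R (from t)
    from∘to  : ∀ {t} → size t ≡ m → R t → from (to t) ≡ t
    to∘from  : ∀ {t} → size t ≡ n → S t → to (from t) ≡ t

module _ {m n} {P : Cand m → Set} {Q : Cand n → Set} {R S : Forest → Set} where

  private
    transport : ∀ {k l} {R′ S′ : Forest → Set} (φ : Forest → Forest) →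
      (∀ {t} → size t ≡ k → R′ t → size (φ t) ≡ l × S′ (φ t)) →
      ∀ {v} → IsTL {k} v → R′ (forest k v) →
      IsTL {l} (diagram l (φ (forest k v))) × S′ (forest l (diagram l (φ (forest k v))))
    transport {k} {l} {S′ = S′} φ φ-ok {v} tl r =
      let size≡ , s = φ-ok (proj₁ (forest-correct {k} v tl)) r
          tl′ , _ , back = diagram-correct (φ (forest k v)) size≡
      in tl′ , subst S′ (sym back) s

  length-filter-allVecs-≡ : (P? : Decidable P) (Q? : Decidable Q) →
    SelectsForests m P R → SelectsForests n Q S → SizedForestBijection m R n S →
    length (filter P? (allVecs (m + m))) ≡ length (filter Q? (allVecs (n + n)))
  length-filter-allVecs-≡ P? Q? SP SQ φ = length-filter-≡-by-bijection P? Q?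
    (allVecs-Unique (m + m)) (allVecs-Unique (n + n)) (∈-allVecs (m + m)) (∈-allVecs (n + n))
    f g f-ok g-ok gf fg
    where
    open SizedForestBijection φ
    module SP = SelectsForests SP
    module SQ = SelectsForests SQ
    f : Cand m → Cand n
    f v = diagram n (to (forest m v))
    g : Cand n → Cand m
    g w = diagram m (from (forest n w))
    f-ok : ∀ {v} → P v → Q (f v)
    f-ok p = let tl , r = SP.sound p ; tl′ , s = transport {S′ = S} to to-ok tl r in SQ.complete tl′ s
    g-ok : ∀ {w} → Q w → P (g w)
    g-ok q = let tl , s = SQ.sound q ; tl′ , r = transport {S′ = R} from from-ok tl s in SP.complete tl′ r
    gf : ∀ {v} → P v → g (f v) ≡ v
    gf {v} p = let tl , r = SP.sound p ; size≡ , back = forest-correct {m} v tl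
                   size′ , _ = to-ok size≡ r
               in begin
      diagram m (from (forest n (diagram n (to (forest m v)))))
        ≡⟨ cong (diagram m ∘ from) (proj₂ (proj₂ (diagram-correct _ size′))) ⟩
      diagram m (from (to (forest m v)))   ≡⟨ cong (diagram m) (from∘to size≡ r) ⟩
      diagram m (forest m v)               ≡⟨ back ⟩
      v                                    ∎
      where open ≡-Reasoning
    fg : ∀ {w} → Q w → f (g w) ≡ w
    fg {w} q = let tl , s = SQ.sound q ; size≡ , back = forest-correct {n} w tl
                   size′ , _ = from-ok size≡ s
               in begin
      diagram n (to (forest m (diagram m (from (forest n w)))))
        ≡⟨ cong (diagram n ∘ to) (proj₂ (proj₂ (diagram-correct _ size′))) ⟩
      diagram n (to (from (forest n w)))   ≡⟨ cong (diagram n) (to∘from size≡ s) ⟩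
      diagram n (forest n w)               ≡⟨ back ⟩
      w                                    ∎
      where open ≡-Reasoning

-- The recurrence for χ

HasExposed : ∀ n → ℕ → Cand n → Set
HasExposed n k v = IsTL {n} v × exposedLeft {n} v ≡ k

hasExposed? : ∀ n k → Decidable (HasExposed n k)
hasExposed? n k v = isTL? {n} v ×-dec (exposedLeft {n} v Data.Nat.≟ k)

hasExposed-selects : ∀ n k → SelectsForests n (HasExposed n k) (λ t → roots t ≡ k)
hasExposed-selects n k = record
  { sound    = λ {v} (tl , e) → tl , trans (sym (exposedLeft≡roots-forest {n} v tl)) e
  ; complete = λ {v} tl r → tl , trans (exposedLeft≡roots-forest {n} v tl) r }

selects-× : ∀ {n P R} (T : Forest → Set) → SelectsForests n P R →
  SelectsForests n (λ v → P v × T (forest n v)) (λ t → R t × T t)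
selects-× T S = record
  { sound    = λ (p , x) → let tl , r = sound p in tl , r , x
  ; complete = λ tl (r , x) → complete tl r , x }
  where open SelectsForests S

χ≡0 : ∀ n k → (∀ {t} → size t ≡ n → roots t ≢ k) → χ n k ≡ 0
χ≡0 n k none = cong length (filter-none (hasExposed? n k) {allVecs (n + n)} (All.universal noForest _))
  where
  noForest : ∀ v → ¬ HasExposed n k v
  noForest v (tl , e) = none (ForestOf.size-forest {n} v tl) (trans (sym (exposedLeft≡roots-forest {n} v tl)) e)

χ-zero : ∀ m → χ (suc m) 0 ≡ 0
χ-zero m = χ≡0 (suc m) 0 noRoots
  where
  noRoots : ∀ {t} → size t ≡ suc m → roots t ≢ 0
  noRoots {∅} ()
  noRoots {node _ _} _ ()

χ-above : ∀ {n k} → n < k → χ n k ≡ 0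
χ-above {n} {k} n<k = χ≡0 n k λ {t} size≡ roots≡ → <⇒≱ n<k (subst₂ _≤_ roots≡ size≡ (roots≤size t))

FirstRootIsLeaf : Forest → Set
FirstRootIsLeaf ∅                     = ⊥
FirstRootIsLeaf (node ∅ _)            = ⊤
FirstRootIsLeaf (node (node _ _) _)   = ⊥

firstRootIsLeaf? : Decidable FirstRootIsLeaf
firstRootIsLeaf? ∅                   = no λ ()
firstRootIsLeaf? (node ∅ _)          = yes tt
firstRootIsLeaf? (node (node _ _) _) = no λ ()

tail : Forest → Forest
tail ∅          = ∅
tail (node _ f) = f

removeLeafRoot : ∀ m k →
  SizedForestBijection (suc m) (λ t → roots t ≡ suc k × FirstRootIsLeaf t) m (λ t → roots t ≡ k)
removeLeafRoot m k = record
  { to = tail ; from = node ∅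
  ; to-ok = to-ok ; from-ok = λ size≡ roots≡ → cong suc size≡ , cong suc roots≡ , tt
  ; from∘to = from∘to ; to∘from = λ _ _ → refl }
  where
  to-ok : ∀ {t} → size t ≡ suc m → roots t ≡ suc k × FirstRootIsLeaf t → size (tail t) ≡ m × roots (tail t) ≡ k
  to-ok {node ∅ _} size≡ (roots≡ , _) = suc-injective size≡ , suc-injective roots≡
  from∘to : ∀ {t} → size t ≡ suc m → roots t ≡ suc k × FirstRootIsLeaf t → node ∅ (tail t) ≡ t
  from∘to {node ∅ _} _ _ = refl

rotateʳ : Forest → Forest
rotateʳ (node (node p q) r) = node p (node q r)
rotateʳ t                   = t

rotateˡ : Forest → Forest
rotateˡ (node p (node q r)) = node (node p q) r
rotateˡ t                   = t

size-rotate : ∀ p q r → size (node (node p q) r) ≡ size (node p (node q r))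
size-rotate p q r = cong suc (trans (cong suc (+-assoc (size p) (size q) (size r))) (sym (+-suc (size p) _)))

rotation : ∀ n k →
  SizedForestBijection n (λ t → roots t ≡ suc k × ¬ FirstRootIsLeaf t) n (λ t → roots t ≡ suc (suc k))
rotation n k = record
  { to = rotateʳ ; from = rotateˡ ; to-ok = to-ok ; from-ok = from-ok ; from∘to = from∘to ; to∘from = to∘from }
  where
  to-ok : ∀ {t} → size t ≡ n → roots t ≡ suc k × ¬ FirstRootIsLeaf t →
    size (rotateʳ t) ≡ n × roots (rotateʳ t) ≡ suc (suc k)
  to-ok {node ∅ _}            _      (_ , notLeaf)  = ⊥-elim (notLeaf tt)
  to-ok {node (node p q) r}   size≡  (roots≡ , _)   = trans (sym (size-rotate p q r)) size≡ , cong suc roots≡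
  from-ok : ∀ {t} → size t ≡ n → roots t ≡ suc (suc k) →
    size (rotateˡ t) ≡ n × roots (rotateˡ t) ≡ suc k × ¬ FirstRootIsLeaf (rotateˡ t)
  from-ok {node p (node q r)} size≡ roots≡ = trans (size-rotate p q r) size≡ , suc-injective roots≡ , λ ()
  from∘to : ∀ {t} → size t ≡ n → roots t ≡ suc k × ¬ FirstRootIsLeaf t → rotateˡ (rotateʳ t) ≡ t
  from∘to {node ∅ _}          _ (_ , notLeaf) = ⊥-elim (notLeaf tt)
  from∘to {node (node p q) r} _ _             = refl
  to∘from : ∀ {t} → size t ≡ n → roots t ≡ suc (suc k) → rotateʳ (rotateˡ t) ≡ t
  to∘from {node p (node q r)} _ _ = refl

χ-recurrence : ∀ m k → χ (suc m) (suc k) ≡ χ m k + χ (suc m) (suc (suc k))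
χ-recurrence m k = trans (length-filter-by-cases (hasExposed? n (suc k)) leaf? (allVecs (n + n)))
  (cong₂ _+_
    (length-filter-allVecs-≡ (λ v → hasExposed? n (suc k) v ×-dec leaf? v) (hasExposed? m k)
      (selects-× FirstRootIsLeaf (hasExposed-selects n (suc k))) (hasExposed-selects m k) (removeLeafRoot m k))
    (length-filter-allVecs-≡ (λ v → hasExposed? n (suc k) v ×-dec ¬? (leaf? v)) (hasExposed? n (suc (suc k)))
      (selects-× (¬_ ∘ FirstRootIsLeaf) (hasExposed-selects n (suc k))) (hasExposed-selects n (suc (suc k))) (rotation n k)))
  where
  n = suc m
  leaf? = λ (v : Cand n) → firstRootIsLeaf? (forest n v)

χ-diagonal : ∀ n → χ n n ≡ 1
χ-diagonal zero    = refl
χ-diagonal (suc n) = begin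
  χ (suc n) (suc n)                        ≡⟨ χ-recurrence n n ⟩
  χ n n + χ (suc n) (suc (suc n))          ≡⟨ cong₂ _+_ (χ-diagonal n) (χ-above (n<1+n (suc n))) ⟩
  1                                        ∎
  where open ≡-Reasoning

χ-subdiagonal : ∀ j → χ (suc (suc j)) (suc j) ≡ suc j
χ-subdiagonal zero = begin
  χ 2 1          ≡⟨ χ-recurrence 1 0 ⟩
  χ 1 0 + χ 2 2  ≡⟨ cong₂ _+_ (χ-zero 0) (χ-diagonal 2) ⟩
  1              ∎
  where open ≡-Reasoning
χ-subdiagonal (suc j) = begin
  χ (3 + j) (2 + j)                    ≡⟨ χ-recurrence (2 + j) (1 + j) ⟩
  χ (2 + j) (1 + j) + χ (3 + j) (3 + j) ≡⟨ cong₂ _+_ (χ-subdiagonal j) (χ-diagonal (3 + j)) ⟩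
  suc j + 1                            ≡⟨ +-comm (suc j) 1 ⟩
  2 + j                                ∎
  where open ≡-Reasoning

-- Ballot and Catalan numbers

nC[k+1]*[k+1]+nCk*k≡nCk*n : ∀ n k → (n C suc k) * suc k + (n C k) * k ≡ (n C k) * n
nC[k+1]*[k+1]+nCk*k≡nCk*n zero zero = refl
nC[k+1]*[k+1]+nCk*k≡nCk*n zero (suc k)
  rewrite k>n⇒nCk≡0 {0} {suc k} z<s | k>n⇒nCk≡0 {0} {suc (suc k)} z<s = refl
nC[k+1]*[k+1]+nCk*k≡nCk*n (suc n) zero = begin
  (suc n C 1) * 1 + 1 * 0   ≡⟨ cong (λ z → z * 1 + 1 * 0) (nC1≡n (suc n)) ⟩
  suc n * 1 + 1 * 0         ≡⟨ normalise (suc n) ⟩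
  1 * suc n                 ∎
  where
  open ≡-Reasoning
  normalise : ∀ n → n * 1 + 1 * 0 ≡ 1 * n
  normalise = solve-∀
nC[k+1]*[k+1]+nCk*k≡nCk*n (suc n) (suc k) = begin
  (suc n C suc (suc k)) * suc (suc k) + (suc n C suc k) * suc k
    ≡⟨ cong₂ (λ x y → x * suc (suc k) + y * suc k) (nCk+nC[k+1]≡[n+1]C[k+1] n (suc k)) (nCk+nC[k+1]≡[n+1]C[k+1] n k) ⟨
  (b + c) * suc (suc k) + (a + b) * suc k
    ≡⟨ regroup a b c k ⟩
  (c * suc (suc k) + b * suc k) + (b * suc k + a * k) + a + b
    ≡⟨ cong₂ (λ x y → x + y + a + b) (nC[k+1]*[k+1]+nCk*k≡nCk*n n (suc k)) (nC[k+1]*[k+1]+nCk*k≡nCk*n n k) ⟩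
  b * n + a * n + a + b
    ≡⟨ collect a b n ⟩
  (a + b) * suc n
    ≡⟨ cong (_* suc n) (nCk+nC[k+1]≡[n+1]C[k+1] n k) ⟩
  (suc n C suc k) * suc n ∎
  where
  open ≡-Reasoning
  a = n C k
  b = n C suc k
  c = n C suc (suc k)
  regroup : ∀ a b c k → (b + c) * suc (suc k) + (a + b) * suc k ≡ (c * suc (suc k) + b * suc k) + (b * suc k + a * k) + a + b
  regroup = solve-∀
  collect : ∀ a b n → b * n + a * n + a + b ≡ (a + b) * suc n
  collect = solve-∀

-- χ (n , r) is the ballot number C(2n-r-1, n-1) - C(2n-r-1, n), here in subtraction-free form
-- with n = 1 + k + j and r = 1 + k.
χ-ballot : ∀ j k → χ (suc k + j) (suc k) + (k + (j + j)) C suc (k + j) ≡ (k + (j + j)) C (k + j)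
χ-ballot zero k rewrite +-identityʳ k = begin
  χ (suc k) (suc k) + k C suc k   ≡⟨ cong₂ _+_ (χ-diagonal (suc k)) (k>n⇒nCk≡0 (n<1+n k)) ⟩
  1                               ≡⟨ nCn≡1 k ⟨
  k C k                           ∎
  where open ≡-Reasoning
χ-ballot (suc j) zero = begin
  χ (2 + j) 1 + (suc j + suc j) C (2 + j)
    ≡⟨ cong₂ (λ x y → x + y C (2 + j)) (trans (χ-recurrence (suc j) 0) (cong (_+ χ (2 + j) 2) (χ-zero j))) 2j+2≡1+M ⟩
  χ (2 + j) 2 + suc M C (2 + j)
    ≡⟨ cong (χ (2 + j) 2 +_) (nCk+nC[k+1]≡[n+1]C[k+1] M (suc j)) ⟨
  χ (2 + j) 2 + (M C (1 + j) + M C (2 + j))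
    ≡⟨ swap (χ (2 + j) 2) (M C (1 + j)) (M C (2 + j)) ⟩
  (χ (2 + j) 2 + M C (2 + j)) + M C (1 + j)
    ≡⟨ cong₂ _+_ (χ-ballot j 1) symmetric ⟩
  M C (1 + j) + M C j
    ≡⟨ +-comm (M C (1 + j)) (M C j) ⟩
  M C j + M C (1 + j)
    ≡⟨ nCk+nC[k+1]≡[n+1]C[k+1] M j ⟩
  suc M C (1 + j)
    ≡⟨ cong (_C (1 + j)) 2j+2≡1+M ⟨
  (suc j + suc j) C suc j ∎
  where
  open ≡-Reasoning
  M = suc (j + j)
  2j+2≡1+M : suc j + suc j ≡ suc M
  2j+2≡1+M = cong suc (+-suc j j)
  symmetric : M C (1 + j) ≡ M C j
  symmetric = trans (nCk≡nC[n∸k] (s≤s (m≤n+m j j))) (cong (M C_) (m+n∸m≡n (suc j) j))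
  swap : ∀ x p q → x + (p + q) ≡ (x + q) + p
  swap = solve-∀
χ-ballot (suc j) (suc k) = begin
  χ (suc n) (2 + k) + suc M C suc (suc K)
    ≡⟨ cong (_+ suc M C suc (suc K)) (χ-recurrence n (suc k)) ⟩
  (χ n (suc k) + χ (suc n) (3 + k)) + suc M C suc (suc K)
    ≡⟨ cong (λ z → (χ n (suc k) + χ (suc (suc z)) (3 + k)) + suc M C suc (suc K)) (+-suc k j) ⟩
  (χ n (suc k) + χ (3 + k + j) (3 + k)) + suc M C suc (suc K)
    ≡⟨ cong ((χ n (suc k) + χ (3 + k + j) (3 + k)) +_) (nCk+nC[k+1]≡[n+1]C[k+1] M (suc K)) ⟨
  (χ n (suc k) + χ (3 + k + j) (3 + k)) + (M C suc K + M C suc (suc K))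
    ≡⟨ interchange (χ n (suc k)) (χ (3 + k + j) (3 + k)) (M C suc K) (M C suc (suc K)) ⟩
  (χ n (suc k) + M C suc K) + (χ (3 + k + j) (3 + k) + M C suc (suc K))
    ≡⟨ cong₂ _+_ (χ-ballot (suc j) k) shifted ⟩
  M C K + M C suc K
    ≡⟨ nCk+nC[k+1]≡[n+1]C[k+1] M K ⟩
  suc M C suc K ∎
  where
  open ≡-Reasoning
  n = suc k + suc j
  M = k + (suc j + suc j)
  K = k + suc j
  interchange : ∀ a b c d → (a + b) + (c + d) ≡ (a + c) + (b + d)
  interchange = solve-∀
  M≡ : suc (suc (k + (j + j))) ≡ M
  M≡ = sym (trans (+-suc k (j + suc j)) (cong suc (trans (cong (k +_) (+-suc j j)) (+-suc k (j + j)))))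
  shifted : χ (3 + k + j) (3 + k) + M C suc (suc K) ≡ M C suc K
  shifted = subst₂ (λ a b → χ (3 + k + j) (3 + k) + a C suc (suc b) ≡ a C suc b) M≡ (sym (+-suc k j))
    (χ-ballot j (suc (suc k)))

χ-catalan : ∀ m → χ (suc m) 1 ≡ catalan m
χ-catalan m = sym (begin
  catalan m              ≡⟨ cong (λ z → (z C m) / suc m) (cong (m +_) (+-identityʳ m)) ⟩
  a / suc m              ≡⟨ cong (_/ suc m) χ*[m+1]≡a ⟨
  χ (suc m) 1 * suc m / suc m ≡⟨ m*n/n≡m (χ (suc m) 1) (suc m) ⟩
  χ (suc m) 1            ∎)
  where
  open ≡-Reasoning
  X = χ (suc m) 1
  a = (m + m) C m
  b = (m + m) C suc m
  X+b≡a : X + b ≡ a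
  X+b≡a = χ-ballot m 0
  b*[m+1]≡a*m : b * suc m ≡ a * m
  b*[m+1]≡a*m = +-cancelˡ-≡ (a * m) (b * suc m) (a * m)
    (trans (+-comm (a * m) (b * suc m)) (trans (nC[k+1]*[k+1]+nCk*k≡nCk*n (m + m) m) (*-distribˡ-+ a m m)))
  χ*[m+1]≡a : X * suc m ≡ a
  χ*[m+1]≡a = +-cancelˡ-≡ (a * m) (X * suc m) a (begin
    a * m + X * suc m    ≡⟨ cong (_+ X * suc m) b*[m+1]≡a*m ⟨
    b * suc m + X * suc m ≡⟨ trans (*-distribʳ-+ (suc m) X b) (+-comm (X * suc m) (b * suc m)) ⟨
    (X + b) * suc m      ≡⟨ cong (_* suc m) X+b≡a ⟩
    a * suc m            ≡⟨ trans (*-suc a m) (+-comm a (a * m)) ⟩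
    a * m + a            ∎)

corollary5p15 : ∀ n → 2 ≤ n →
    (χ n 1 ≡ catalan (n ∸ 1)) × (χ n (n ∸ 1) ≡ n ∸ 1) × (χ n n ≡ 1) ×
    (∀ k → 2 ≤ k → k ≤ n ∸ 1 → χ n k ≡ χ (n ∸ 1) (k ∸ 1) + χ n (suc k))
corollary5p15 (suc (suc j)) _ = χ-catalan (suc j) , χ-subdiagonal j , χ-diagonal (suc (suc j)) , recurrence
  where
  recurrence : ∀ k → 2 ≤ k → k ≤ suc j → χ (suc (suc j)) k ≡ χ (suc j) (k ∸ 1) + χ (suc (suc j)) (suc k)
  recurrence (suc k) _ _ = χ-recurrence (suc j) k
corollary5p15 (suc zero) (s≤s ())
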